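{- For each even $n\ge 6$, let $\pi_n^*$ be the permutation of $[n]$ given by $\pi_n^*(1)=4$, $\pi_n^*(2)=2$, $\pi_n^*(2j-3)=2j$ and $\pi_n^*(2j-2)=2j-5$ for $3\le j\le n/2$, $\pi_n^*(n-1)=n-1$, and $\pi_n^*(n)=n-3$ (so e.g. $\pi_6^*=(4,2,6,1,5,3)$ and $\pi_8^*=(4,2,6,1,8,3,7,5)$ in one-line notation). For a permutation $\pi$ of $[n]$, let $T_\pi$ be the bipartite graph with vertex set $A\cup B\cup C\cup D$, where $A=\{a_1,\dots,a_n\}$, $B=\{b_1,\dots,b_n\}$, $C=\{c_1,\dots,c_n\}$, $D=\{d_1,\dots,d_n\}$ are pairwise disjoint, and whose edges are exactly: $a_ib_{\pi(i)}$ for each $i\in[n]$; $c_id_j$ for all $i,j\in[n]$; $a_id_j$ for all $1\le j\le i\le n$; and $b_ic_j$ for all $1\le j\le i\le n$. Then the sequence $T_{\pi_6^*},T_{\pi_8^*},T_{\pi_{10}^*},\dots$ is an antichain with respect to the induced subgraph relation, i.e. for distinct even $m,n\ge 6$, $T_{\pi_m^*}$ is not isomorphic to an induced subgraph of $T_{\pi_n^*}$.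
   Context: All graphs are finite, simple and undirected. One-line notation $(\pi(1),\dots,\pi(n))$ lists the values of a permutation. -}

module Defs where

open import Data.Nat using (ℕ; zero; suc; _+_; _*_; _∸_; _≤_; _≡ᵇ_; _%_)
open import Data.Bool using (Bool; true; false; if_then_else_)
open import Data.Fin using (Fin; toℕ)
open import Data.Product using (_×_; _,_; Σ)
open import Data.Sum using (_⊎_)
open import Data.Unit using (⊤)
open import Data.Empty using (⊥)
open import Relation.Binary.PropositionalEquality using (_≡_)
open import Function using (_⇔_)
open import Function.Definitions using (Injective)

-- π*_n on 1-based indices i ∈ [n] (values outside [n] are irrelevant).
--   π(1)=4, π(2)=2, π(n-1)=n-1, π(n)=n-3,
--   π(2j-3)=2j   (odd i with 3 ≤ i ≤ n-3):  i ↦ i+3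
--   π(2j-2)=2j-5 (even i with 4 ≤ i ≤ n-2): i ↦ i-3
piStar : ℕ → ℕ → ℕ
piStar n i =
  if i ≡ᵇ 1 then 4 else
  if i ≡ᵇ 2 then 2 else
  if i ≡ᵇ (n ∸ 1) then n ∸ 1 else
  if i ≡ᵇ n then n ∸ 3 else
  if (i % 2) ≡ᵇ 0 then i ∸ 3 else i + 3

data Part : Set where
  A B C D : Part

-- Vertices of T_π: (X , i) stands for x_{i+1}, x ∈ {a,b,c,d}, i : Fin n.
Vertex : ℕ → Set
Vertex n = Part × Fin n

idx : {n : ℕ} → Fin n → ℕ
idx i = suc (toℕ i)

E : {n : ℕ} → (ℕ → ℕ) → Vertex n → Vertex n → Set
E π (A , i) (B , j) = idx j ≡ π (idx i)
E π (C , i) (D , j) = ⊤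
E π (A , i) (D , j) = idx j ≤ idx i
E π (B , i) (C , j) = idx j ≤ idx i
E π _ _ = ⊥

Adj : {n : ℕ} → (ℕ → ℕ) → Vertex n → Vertex n → Set
Adj π u v = E π u v ⊎ E π v u

TAdj : (n : ℕ) → Vertex n → Vertex n → Set
TAdj n = Adj (piStar n)

InducedSubgraphOf : {V W : Set} → (V → V → Set) → (W → W → Set) → Set
InducedSubgraphOf {V} {W} G H =
  Σ (V → W) λ f → Injective _≡_ _≡_ f × (∀ u v → G u v ⇔ H (f u) (f v))

module Submission where

-- T_π is bipartite with left side A ∪ C and right
-- side B ∪ D.  Placing a_i and d_i at position i, and c_i and b_i at position
-- 2k + 1 - i, the left vertex at x sees the right vertex at y iff y ≤ x (a threshold
-- edge) or x ≤ k and y = 2k + 1 - π x (a matching edge).  Composing with the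
-- automorphism a ↔ b, c ↔ d if necessary, an induced embedding keeps the sides and
-- becomes a pair of injective position maps α, β preserving and reflecting Edge.
--
-- For such maps, α is strictly increasing on 1 … m and matching edges go to matching
-- edges; hence whenever σ = π*_m orders two positions, π = π*_n orders their α-images
-- the same way.  Since π moves every point by 0 or 3 and fixes only 2 and n - 1, the
-- fixed points 2 and m - 1 of σ, squeezed between neighbouring values, go to 2 and
-- n - 1.  Finally m - 1 ≤ α (m - 1) by monotonicity, and α (m - 1) ≤ m - 1 because σ
-- reverses the ends of every window [i, i + 5] with i odd, which keeps α from
-- stretching; so m - 1 = n - 1.

open import Defs
open import Data.Nat using (ℕ; zero; suc; _+_; _*_; _∸_; _%_; _≡ᵇ_; _≤_; _<_; _≤?_; _<?_; z≤n; s≤s; s≤s⁻¹; NonZero)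
open import Data.Nat.Properties
open import Data.Nat.DivMod using (_mod_; m<n⇒m%n≡m)
open import Data.Nat.Divisibility using (_∣_; divides)
open import Data.Nat.Tactic.RingSolver using (solve-∀)
open import Data.Fin using (Fin; toℕ) renaming (zero to fzero)
open import Data.Fin.Properties using (toℕ<n; toℕ-injective; toℕ-fromℕ<)
open import Data.Bool using (Bool; true; false; not; T)
open import Data.Bool.Properties using (T-≡; ¬-not; not-involutive)
open import Data.Unit using (tt)
open import Data.Product using (_×_; _,_; proj₁; proj₂; ∃-syntax)
open import Data.Sum using (_⊎_; inj₁; inj₂; fromInj₁; fromInj₂) renaming (swap to ⊎-swap)
open import Function using (_⇔_; mk⇔; Equivalence; _∘_)
open import Function.Definitions using (Injective)
open import Function.Properties.Equivalence using () renaming (refl to ⇔-refl; sym to ⇔-sym; trans to ⇔-trans)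
open import Relation.Binary.PropositionalEquality
open import Relation.Nullary using (¬_; yes; no; contradiction)

size : ℕ → ℕ
size u = 6 + (u + u)

Pos : ℕ → ℕ → Set
Pos k x = 1 ≤ x × x ≤ k

Even Odd : ℕ → Set
Even x = ∃[ h ] x ≡ h + h
Odd x = ∃[ h ] x ≡ suc (h + h)

even-or-odd : ∀ x → Even x ⊎ Odd x
even-or-odd zero = inj₁ (0 , refl)
even-or-odd (suc x) with even-or-odd x
... | inj₁ (h , refl) = inj₂ (h , refl)
... | inj₂ (h , refl) = inj₁ (suc h , cong suc (sym (+-suc h h)))

double-%2 : ∀ h → (h + h) % 2 ≡ 0
double-%2 zero = refl
double-%2 (suc h) rewrite +-suc h h = double-%2 h

odd-%2 : ∀ h → suc (h + h) % 2 ≡ 1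
odd-%2 zero = refl
odd-%2 (suc h) rewrite +-suc h h = odd-%2 h

double≢odd : ∀ h j → h + h ≢ suc (j + j)
double≢odd h j e = 0≢1+n (trans (sym (double-%2 h)) (trans (cong (_% 2) e) (odd-%2 j)))

half-< : ∀ {h j} → h + h < j + j → h < j
half-< {h} {j} lt with h <? j
... | yes h<j = h<j
... | no h≮j = contradiction lt (≤⇒≯ (+-mono-≤ (≮⇒≥ h≮j) (≮⇒≥ h≮j)))

≡ᵇ-true : ∀ {x y} → (x ≡ᵇ y) ≡ true → x ≡ y
≡ᵇ-true {x} {y} e = ≡ᵇ⇒≡ x y (Equivalence.from T-≡ e)

≡ᵇ-false : ∀ {x y} → (x ≡ᵇ y) ≡ false → x ≢ y
≡ᵇ-false {x} {y} e x≡y = subst T e (≡⇒≡ᵇ x y x≡y)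

data Branch (n x : ℕ) : ℕ → Set where
  at-1      : x ≡ 1 → Branch n x 4
  at-2      : x ≡ 2 → Branch n x 2
  at-penult : x ≡ n ∸ 1 → Branch n x (n ∸ 1)
  at-last   : x ≡ n → Branch n x (n ∸ 3)
  at-even   : ∀ h → x ≡ h + h → x ≢ 2 → Branch n x (x ∸ 3)
  at-odd    : ∀ h → x ≡ suc (h + h) → x ≢ n ∸ 1 → Branch n x (x + 3)

branch : ∀ n x → Branch n x (piStar n x)
branch n x with x ≡ᵇ 1 in e₁
... | true = at-1 (≡ᵇ-true e₁)
... | false with x ≡ᵇ 2 in e₂
... | true = at-2 (≡ᵇ-true e₂)
... | false with x ≡ᵇ n ∸ 1 in e₃
... | true = at-penult (≡ᵇ-true e₃)
... | false with x ≡ᵇ n in e₄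
... | true = at-last (≡ᵇ-true e₄)
... | false with even-or-odd x
... | inj₁ (h , refl) rewrite double-%2 h = at-even h refl (≡ᵇ-false e₂)
... | inj₂ (h , refl) rewrite odd-%2 h = at-odd h refl (≡ᵇ-false e₃)

∸3-moves : ∀ {x} → 3 ≤ x → x ∸ 3 ≢ x
∸3-moves {x} 3≤x e = m+1+n≢m x (trans (cong (_+ 3) (sym e)) (m∸n+n≡m 3≤x))

+3-moves : ∀ x → x + 3 ≢ x
+3-moves x = m+1+n≢m x

double-≥4 : ∀ h → 1 ≤ h + h → h + h ≢ 2 → 4 ≤ h + h
double-≥4 zero () _
double-≥4 (suc zero) _ ≢2 = contradiction refl ≢2
double-≥4 (suc (suc h)) _ _ = +-mono-≤ (s≤s (s≤s z≤n)) (s≤s (s≤s z≤n))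

odd-shift : ∀ h → suc (h + h) + 3 ≡ (2 + h) + (2 + h)
odd-shift = solve-∀

size-double : ∀ u → 6 + (u + u) ≡ (3 + u) + (3 + u)
size-double = solve-∀

size-pred-odd : ∀ u → 5 + (u + u) ≡ suc ((2 + u) + (2 + u))
size-pred-odd = solve-∀

module PiStar (u : ℕ) where
  n : ℕ
  n = size u

  π : ℕ → ℕ
  π = piStar n

  n-double : n ≡ (3 + u) + (3 + u)
  n-double = size-double u

  penult-odd : n ∸ 1 ≡ suc ((2 + u) + (2 + u))
  penult-odd = size-pred-odd u

  odd-room : ∀ h → suc (h + h) ≤ n → suc (h + h) ≢ n ∸ 1 → suc (h + h) + 3 ≤ n
  odd-room h x≤n x≢n-1 = begin
    suc (h + h) + 3     ≡⟨ odd-shift h ⟩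
    (2 + h) + (2 + h)   ≤⟨ +-mono-≤ 2+h≤3+u 2+h≤3+u ⟩
    (3 + u) + (3 + u)   ≡⟨ n-double ⟨
    n                   ∎
    where
    open ≤-Reasoning
    h<3+u : h < 3 + u
    h<3+u = half-< (subst (suc (h + h) ≤_) n-double x≤n)
    h≢2+u : h ≢ 2 + u
    h≢2+u refl = x≢n-1 (sym penult-odd)
    2+h≤3+u : 2 + h ≤ 3 + u
    2+h≤3+u = s≤s (≤∧≢⇒< (s≤s⁻¹ h<3+u) h≢2+u)

  π-odd : ∀ h → suc (h + h) + 3 ≤ n → π (suc (h + h)) ≡ suc (h + h) + 3
  π-odd h room with π (suc (h + h)) | branch n (suc (h + h))
  ... | _ | at-1 x≡1 = cong (_+ 3) (sym x≡1)
  ... | _ | at-2 x≡2 = contradiction (sym x≡2) (double≢odd 1 h)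
  ... | _ | at-penult x≡n-1 = contradiction (m+n≤o⇒m≤o∸n _ (subst (λ z → z + 3 ≤ n) x≡n-1 room))
                                             (<⇒≱ (s≤s (s≤s (s≤s (s≤s (n≤1+n (u + u)))))))
  ... | _ | at-last x≡n = contradiction (sym (trans x≡n n-double)) (double≢odd (3 + u) h)
  ... | _ | at-even j x≡2j _ = contradiction (sym x≡2j) (double≢odd j h)
  ... | _ | at-odd _ _ _ = refl

  π-even : ∀ h → 2 ≤ h → h + h ≤ n → π (h + h) ≡ h + h ∸ 3
  π-even h 2≤h x≤n with π (h + h) | branch n (h + h)
  ... | _ | at-1 x≡1 = contradiction x≡1 (double≢odd h 0)
  ... | _ | at-2 x≡2 = contradiction (subst (4 ≤_) x≡2 (+-mono-≤ 2≤h 2≤h)) (<⇒≱ (n≤1+n 3))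
  ... | _ | at-penult x≡n-1 = contradiction (trans x≡n-1 penult-odd) (double≢odd h (2 + u))
  ... | _ | at-last x≡n = cong (_∸ 3) (sym x≡n)
  ... | _ | at-even _ _ _ = refl
  ... | _ | at-odd j x≡2j+1 _ = contradiction x≡2j+1 (double≢odd h j)

  π-penult : π (n ∸ 1) ≡ n ∸ 1
  π-penult with π (n ∸ 1) | branch n (n ∸ 1)
  ... | _ | at-penult _ = refl
  ... | _ | at-last x≡n = contradiction (sym x≡n) 1+n≢n
  ... | _ | at-even j x≡2j _ = contradiction (trans (sym x≡2j) penult-odd) (double≢odd j (2 + u))
  ... | _ | at-odd _ _ x≢n-1 = contradiction refl x≢n-1

  π-even-odd : ∀ h → suc (h + h) + 3 ≤ n → π ((2 + h) + (2 + h)) ≡ suc (h + h)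
  π-even-odd h room = begin
    π ((2 + h) + (2 + h))     ≡⟨ π-even (2 + h) (s≤s (s≤s z≤n)) (subst (_≤ n) (odd-shift h) room) ⟩
    (2 + h) + (2 + h) ∸ 3     ≡⟨ cong (_∸ 3) (odd-shift h) ⟨
    suc (h + h) + 3 ∸ 3       ≡⟨ m+n∸n≡m _ 3 ⟩
    suc (h + h)               ∎
    where open ≡-Reasoning

  π-odd-even : ∀ h → (2 + h) + (2 + h) ≤ n → π ((2 + h) + (2 + h) ∸ 3) ≡ (2 + h) + (2 + h)
  π-odd-even h x≤n = begin
    π ((2 + h) + (2 + h) ∸ 3) ≡⟨ cong (λ z → π (z ∸ 3)) (odd-shift h) ⟨
    π (suc (h + h) + 3 ∸ 3)   ≡⟨ cong π (m+n∸n≡m (suc (h + h)) 3) ⟩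
    π (suc (h + h))           ≡⟨ π-odd h (subst (_≤ n) (sym (odd-shift h)) x≤n) ⟩
    suc (h + h) + 3           ≡⟨ odd-shift h ⟩
    (2 + h) + (2 + h)         ∎
    where open ≡-Reasoning

  π-last : π n ≡ n ∸ 3
  π-last = subst (λ z → π z ≡ z ∸ 3) (sym n-double) (π-even (3 + u) (s≤s (s≤s z≤n)) (≤-reflexive (sym n-double)))

  π-third-last : π (n ∸ 3) ≡ n
  π-third-last = subst (λ z → π (z ∸ 3) ≡ z) (sym n-double) (π-odd-even (1 + u) (≤-reflexive (sym n-double)))

  π-involutive : ∀ {x} → Pos n x → π (π x) ≡ x
  π-involutive {x} (1≤x , x≤n) with π x | branch n x
  ... | _ | at-1 refl = π-even-odd 0 (s≤s (s≤s (s≤s (s≤s z≤n))))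
  ... | _ | at-2 refl = refl
  ... | _ | at-penult refl = π-penult
  ... | _ | at-last refl = π-third-last
  ... | _ | at-even zero refl _ = contradiction 1≤x λ ()
  ... | _ | at-even (suc zero) refl x≢2 = contradiction refl x≢2
  ... | _ | at-even (suc (suc h)) refl _ = π-odd-even h x≤n
  ... | _ | at-odd h refl x≢n-1 = trans (cong π (odd-shift h)) (π-even-odd h (odd-room h x≤n x≢n-1))

  π-range : ∀ {x} → Pos n x → Pos n (π x)
  π-range {x} (1≤x , x≤n) with π x | branch n x
  ... | _ | at-1 _ = s≤s z≤n , s≤s (s≤s (s≤s (s≤s z≤n)))
  ... | _ | at-2 _ = s≤s z≤n , s≤s (s≤s z≤n)
  ... | _ | at-penult _ = s≤s z≤n , n≤1+n _
  ... | _ | at-last _ = s≤s z≤n , m∸n≤m n 3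
  ... | _ | at-even h refl x≢2 = ∸-monoˡ-≤ 3 (double-≥4 h 1≤x x≢2) , ≤-trans (m∸n≤m x 3) x≤n
  ... | _ | at-odd h refl x≢n-1 = s≤s z≤n , odd-room h x≤n x≢n-1

  π-injective : ∀ {x y} → Pos n x → Pos n y → π x ≡ π y → x ≡ y
  π-injective {x} {y} px py e = begin
    x         ≡⟨ π-involutive px ⟨
    π (π x)   ≡⟨ cong π e ⟩
    π (π y)   ≡⟨ π-involutive py ⟩
    y         ∎
    where open ≡-Reasoning

  π-displacement : ∀ x → π x ≡ x ⊎ π x ≡ x + 3 ⊎ π x + 3 ≡ x
  π-displacement x with π x | branch n x
  ... | _ | at-1 refl = inj₂ (inj₁ refl)
  ... | _ | at-2 refl = inj₁ refl
  ... | _ | at-penult refl = inj₁ refl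
  ... | _ | at-last refl = inj₂ (inj₂ (m∸n+n≡m (s≤s (s≤s (s≤s z≤n)))))
  ... | _ | at-even zero refl _ = inj₁ refl
  ... | _ | at-even (suc zero) refl x≢2 = contradiction refl x≢2
  ... | _ | at-even h@(suc (suc _)) refl x≢2 =
    inj₂ (inj₂ (m∸n+n≡m (≤-trans (n≤1+n 3) (double-≥4 h (s≤s z≤n) x≢2))))
  ... | _ | at-odd _ _ _ = inj₂ (inj₁ refl)

  π-fixed : ∀ {x} → 1 ≤ x → π x ≡ x → x ≡ 2 ⊎ x ≡ n ∸ 1
  π-fixed {x} 1≤x fixed with π x | branch n x
  ... | _ | at-1 refl = contradiction fixed λ ()
  ... | _ | at-2 x≡2 = inj₁ x≡2
  ... | _ | at-penult x≡n-1 = inj₂ x≡n-1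
  ... | _ | at-last refl = contradiction fixed (∸3-moves (s≤s (s≤s (s≤s z≤n))))
  ... | _ | at-even h refl x≢2 = contradiction fixed (∸3-moves (≤-trans (n≤1+n 3) (double-≥4 h 1≤x x≢2)))
  ... | _ | at-odd _ _ _ = contradiction fixed (+3-moves x)

  π-lower : ∀ x → x ≤ π x + 3
  π-lower x with π-displacement x
  ... | inj₁ fixed = ≤-trans (≤-reflexive (sym fixed)) (m≤m+n (π x) 3)
  ... | inj₂ (inj₁ up) = ≤-trans (m≤m+n x 3) (≤-trans (≤-reflexive (sym up)) (m≤m+n (π x) 3))
  ... | inj₂ (inj₂ down) = ≤-reflexive (sym down)

  π-upper : ∀ x → π x ≤ x + 3
  π-upper x with π-displacement x
  ... | inj₁ fixed = ≤-trans (≤-reflexive fixed) (m≤m+n x 3)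
  ... | inj₂ (inj₁ up) = ≤-reflexive up
  ... | inj₂ (inj₂ down) = ≤-trans (m≤m+n (π x) 3) (≤-trans (≤-reflexive down) (m≤m+n x 3))

  -- If π x lies strictly between the values of π at a position z ≥ x and
  -- a position y ≤ x, then x is a fixed point: its displacement is below 3.
  π-squeeze : ∀ {x y z} → y ≤ x → x ≤ z → π z < π x → π x < π y → π x ≡ x
  π-squeeze {x} {y} {z} y≤x x≤z πz<πx πx<πy with π-displacement x
  ... | inj₁ fixed = fixed
  ... | inj₂ (inj₁ up) = contradiction (<-≤-trans πx<πy (≤-trans (π-upper y) (+-monoˡ-≤ 3 y≤x))) (<-irrefl up)
  ... | inj₂ (inj₂ down) = contradiction (≤-<-trans x≤z (≤-<-trans (π-lower z) (+-monoˡ-< 3 πz<πx))) (<-irrefl (sym down))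

-- Edge π k x y: in T_π the left vertex at position x sees the right vertex at position y.
Edge : (ℕ → ℕ) → ℕ → ℕ → ℕ → Set
Edge π k x y = y ≤ x ⊎ (x ≤ k × y + π x ≡ suc (k + k))

leftPart : Part → Bool
leftPart A = true
leftPart B = false
leftPart C = true
leftPart D = false

isLeft : ∀ {k} → Vertex k → Bool
isLeft (X , _) = leftPart X

edge-crosses : ∀ {k π} (p q : Vertex k) → E π p q → isLeft p ≢ isLeft q
edge-crosses (A , _) (B , _) _ = λ ()
edge-crosses (A , _) (D , _) _ = λ ()
edge-crosses (B , _) (C , _) _ = λ ()
edge-crosses (C , _) (D , _) _ = λ ()
edge-crosses (A , _) (A , _) ()
edge-crosses (A , _) (C , _) ()
edge-crosses (B , _) (A , _) ()
edge-crosses (B , _) (B , _) ()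
edge-crosses (B , _) (D , _) ()
edge-crosses (C , _) (A , _) ()
edge-crosses (C , _) (B , _) ()
edge-crosses (C , _) (C , _) ()
edge-crosses (D , _) (_ , _) ()

adjacent-crosses : ∀ {k π} (p q : Vertex k) → Adj π p q → isLeft p ≢ isLeft q
adjacent-crosses p q (inj₁ e) = edge-crosses p q e
adjacent-crosses p q (inj₂ e) = edge-crosses q p e ∘ sym

-- Positions along each side: a_i and d_i sit at i, c_i and b_i at 2k + 1 - i.
descending-pos : (k : ℕ) → Fin k → ℕ
descending-pos k i = k + k ∸ toℕ i

pos : ∀ {k} → Vertex k → ℕ
pos (A , i) = idx i
pos {k} (B , i) = descending-pos k i
pos {k} (C , i) = descending-pos k i
pos (D , i) = idx i

idx≤ : ∀ {k} (i : Fin k) → idx i ≤ k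
idx≤ = toℕ<n

toℕ≤2k : ∀ {k} (i : Fin k) → toℕ i ≤ k + k
toℕ≤2k {k} i = ≤-trans (<⇒≤ (toℕ<n i)) (m≤m+n k k)

descending-large : ∀ {k} (i : Fin k) → k < descending-pos k i
descending-large {k} i = subst (k <_) (sym (+-∸-assoc k (<⇒≤ (toℕ<n i)))) (m<m+n k (m<n⇒0<n∸m (toℕ<n i)))

descending-sum : ∀ {k} (i : Fin k) → descending-pos k i + idx i ≡ suc (k + k)
descending-sum {k} i = trans (+-suc _ _) (cong suc (m∸n+n≡m (toℕ≤2k i)))

pos-positive : ∀ {k} (v : Vertex k) → 1 ≤ pos v
pos-positive (A , _) = s≤s z≤n
pos-positive (B , i) = ≤-trans (s≤s z≤n) (descending-large i)
pos-positive (C , i) = ≤-trans (s≤s z≤n) (descending-large i)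
pos-positive (D , _) = s≤s z≤n

adjacency-by-position : ∀ {k π} → (∀ {x} → Pos k x → π x ≤ k) → (p q : Vertex k) →
                        isLeft p ≡ true → isLeft q ≡ false → Adj π p q ⇔ Edge π k (pos p) (pos q)
adjacency-by-position {k} {π} _ (A , i) (B , j) _ _ = mk⇔ to from
  where
  to : Adj π (A , i) (B , j) → Edge π k (idx i) (descending-pos k j)
  to (inj₁ matched) = inj₂ (idx≤ i , trans (cong (descending-pos k j +_) (sym matched)) (descending-sum j))
  from : Edge π k (idx i) (descending-pos k j) → Adj π (A , i) (B , j)
  from (inj₁ below) = contradiction (≤-trans below (idx≤ i)) (<⇒≱ (descending-large j))
  from (inj₂ (_ , sum)) = inj₁ (sym (+-cancelˡ-≡ _ _ _ (trans sum (sym (descending-sum j)))))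
adjacency-by-position {k} {π} π≤k (A , i) (D , j) _ _ = mk⇔ to from
  where
  to : Adj π (A , i) (D , j) → Edge π k (idx i) (idx j)
  to (inj₁ below) = inj₁ below
  from : Edge π k (idx i) (idx j) → Adj π (A , i) (D , j)
  from (inj₁ below) = inj₁ below
  from (inj₂ (_ , sum)) = contradiction sum (<⇒≢ (s≤s (+-mono-≤ (idx≤ j) (π≤k (s≤s z≤n , idx≤ i)))))
adjacency-by-position {k} {π} _ (C , i) (B , j) _ _ = mk⇔ to from
  where
  to : Adj π (C , i) (B , j) → Edge π k (descending-pos k i) (descending-pos k j)
  to (inj₂ i≤j) = inj₁ (∸-monoʳ-≤ (k + k) (s≤s⁻¹ i≤j))
  from : Edge π k (descending-pos k i) (descending-pos k j) → Adj π (C , i) (B , j)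
  from (inj₁ below) with toℕ j <? toℕ i
  ... | yes j<i = contradiction below (<⇒≱ (∸-monoʳ-< j<i (toℕ≤2k i)))
  ... | no j≮i = inj₂ (s≤s (≮⇒≥ j≮i))
  from (inj₂ (small , _)) = contradiction small (<⇒≱ (descending-large i))
adjacency-by-position {k} {π} _ (C , i) (D , j) _ _ =
  mk⇔ (λ _ → inj₁ (<⇒≤ (≤-<-trans (idx≤ j) (descending-large i)))) (λ _ → inj₁ tt)
adjacency-by-position _ (B , _) _ () _
adjacency-by-position _ (D , _) _ () _
adjacency-by-position _ (A , _) (A , _) _ ()
adjacency-by-position _ (A , _) (C , _) _ ()
adjacency-by-position _ (C , _) (A , _) _ ()
adjacency-by-position _ (C , _) (C , _) _ ()

low≢high : ∀ {k} (i j : Fin k) → idx i ≢ descending-pos k j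
low≢high {k} i j e = <⇒≱ (descending-large j) (subst (_≤ k) e (idx≤ i))

low-injective : ∀ {k} {i j : Fin k} → idx i ≡ idx j → i ≡ j
low-injective e = toℕ-injective (suc-injective e)

high-injective : ∀ {k} {i j : Fin k} → descending-pos k i ≡ descending-pos k j → i ≡ j
high-injective {i = i} {j} e = toℕ-injective (∸-cancelˡ-≡ (toℕ≤2k i) (toℕ≤2k j) e)

pos-injective : ∀ {k} (p q : Vertex k) → isLeft p ≡ isLeft q → pos p ≡ pos q → p ≡ q
pos-injective (A , i) (A , j) _ e = cong (A ,_) (low-injective e)
pos-injective (A , i) (C , j) _ e = contradiction e (low≢high i j)
pos-injective (C , i) (A , j) _ e = contradiction (sym e) (low≢high j i)
pos-injective (C , i) (C , j) _ e = cong (C ,_) (high-injective e)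
pos-injective (D , i) (D , j) _ e = cong (D ,_) (low-injective e)
pos-injective (D , i) (B , j) _ e = contradiction e (low≢high i j)
pos-injective (B , i) (D , j) _ e = contradiction (sym e) (low≢high j i)
pos-injective (B , i) (B , j) _ e = cong (B ,_) (high-injective e)
pos-injective (A , _) (B , _) () _
pos-injective (A , _) (D , _) () _
pos-injective (C , _) (B , _) () _
pos-injective (C , _) (D , _) () _
pos-injective (B , _) (A , _) () _
pos-injective (B , _) (C , _) () _
pos-injective (D , _) (A , _) () _
pos-injective (D , _) (C , _) () _

-- The vertex at position x on the side made of the parts low (positions 1 … k)
-- and high (positions k + 1 … 2k); positions outside 1 … 2k give an arbitrary vertex.
vertexAt : (k : ℕ) .{{_ : NonZero k}} → Part → Part → ℕ → Vertex k
vertexAt k low high x with x ≤? k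
... | yes _ = low , (x ∸ 1) mod k
... | no _ = high , (k + k ∸ x) mod k

toℕ-mod : ∀ {k} .{{_ : NonZero k}} {x} → x < k → toℕ (x mod k) ≡ x
toℕ-mod {k} {x} x<k = trans (toℕ-fromℕ< _) (m<n⇒m%n≡m x<k)

pos-vertexAt : ∀ k .{{_ : NonZero k}} low high → (∀ i → pos (low , i) ≡ idx i) →
               (∀ i → pos (high , i) ≡ descending-pos k i) →
               ∀ {x} → Pos (k + k) x → pos (vertexAt k low high x) ≡ x
pos-vertexAt k low high pos-low pos-high {zero} (() , _)
pos-vertexAt k low high pos-low pos-high {suc x} (_ , x≤2k) with suc x ≤? k
... | yes x<k = trans (pos-low _) (cong suc (toℕ-mod x<k))
... | no x≰k = trans (pos-high _) (trans (cong (k + k ∸_) (toℕ-mod 2k-x<k)) (m∸[m∸n]≡n x≤2k))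
  where
  2k-x<k : k + k ∸ suc x < k
  2k-x<k = subst (k + k ∸ suc x <_) (m+n∸n≡m k k) (∸-monoʳ-< (≰⇒> x≰k) x≤2k)

vertexAt-side : ∀ k .{{_ : NonZero k}} low high → leftPart low ≡ leftPart high →
                ∀ x → isLeft (vertexAt k low high x) ≡ leftPart low
vertexAt-side k low high same x with x ≤? k
... | yes _ = refl
... | no _ = sym same

leftAt rightAt : (k : ℕ) .{{_ : NonZero k}} → ℕ → Vertex k
leftAt k = vertexAt k A C
rightAt k = vertexAt k D B

pos-leftAt : ∀ k .{{_ : NonZero k}} {x} → Pos (k + k) x → pos (leftAt k x) ≡ x
pos-leftAt k = pos-vertexAt k A C (λ _ → refl) (λ _ → refl)

pos-rightAt : ∀ k .{{_ : NonZero k}} {x} → Pos (k + k) x → pos (rightAt k x) ≡ x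
pos-rightAt k = pos-vertexAt k D B (λ _ → refl) (λ _ → refl)

leftAt-left : ∀ k .{{_ : NonZero k}} x → isLeft (leftAt k x) ≡ true
leftAt-left k = vertexAt-side k A C refl

rightAt-right : ∀ k .{{_ : NonZero k}} x → isLeft (rightAt k x) ≡ false
rightAt-right k = vertexAt-side k D B refl

-- Exchanging a_i ↔ b_i and c_i ↔ d_i is an automorphism of T_π when π is an involution of 1 … k.
swap : ∀ {k} → Vertex k → Vertex k
swap (A , i) = B , i
swap (B , i) = A , i
swap (C , i) = D , i
swap (D , i) = C , i

swap-involutive : ∀ {k} (v : Vertex k) → swap (swap v) ≡ v
swap-involutive (A , _) = refl
swap-involutive (B , _) = refl
swap-involutive (C , _) = refl
swap-involutive (D , _) = refl

swap-adjacency : ∀ {k π} → (∀ {x} → Pos k x → π (π x) ≡ x) → ∀ p q → Adj π p q ⇔ Adj π (swap p) (swap q)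
swap-adjacency {k} {π} involutive = adj
  where
  flip : ∀ {i j : Fin k} → idx j ≡ π (idx i) → idx i ≡ π (idx j)
  flip {i} e = trans (sym (involutive (s≤s z≤n , idx≤ i))) (cong π (sym e))
  adj : ∀ p q → Adj π p q ⇔ Adj π (swap p) (swap q)
  adj (A , i) (B , j) = mk⇔ (λ { (inj₁ e) → inj₂ (flip e) ; (inj₂ ()) }) (λ { (inj₂ e) → inj₁ (flip e) ; (inj₁ ()) })
  adj (B , i) (A , j) = mk⇔ (λ { (inj₂ e) → inj₁ (flip e) ; (inj₁ ()) }) (λ { (inj₁ e) → inj₂ (flip e) ; (inj₂ ()) })
  adj (C , i) (D , j) = mk⇔ ⊎-swap ⊎-swap
  adj (D , i) (C , j) = mk⇔ ⊎-swap ⊎-swap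
  adj (A , i) (A , j) = ⇔-refl
  adj (A , i) (C , j) = ⇔-refl
  adj (A , i) (D , j) = ⇔-refl
  adj (B , i) (B , j) = ⇔-refl
  adj (B , i) (C , j) = ⇔-refl
  adj (B , i) (D , j) = ⇔-refl
  adj (C , i) (A , j) = ⇔-refl
  adj (C , i) (B , j) = ⇔-refl
  adj (C , i) (C , j) = ⇔-refl
  adj (D , i) (A , j) = ⇔-refl
  adj (D , i) (B , j) = ⇔-refl
  adj (D , i) (D , j) = ⇔-refl

sees-right : ∀ {k π} (q : Vertex (suc k)) → isLeft q ≡ false → Adj π (C , fzero) q
sees-right (B , _) _ = inj₂ (s≤s z≤n)
sees-right (D , _) _ = inj₁ tt
sees-right (A , _) ()
sees-right (C , _) ()

seen-by-d₁ : ∀ {k π} (p : Vertex (suc k)) → isLeft p ≡ true → Adj π p (D , fzero)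
seen-by-d₁ (A , _) _ = inj₁ (s≤s z≤n)
seen-by-d₁ (C , _) _ = inj₁ tt
seen-by-d₁ (B , _) ()
seen-by-d₁ (D , _) ()

module ImageSides {k n σ π} (f : Vertex (suc k) → Vertex n) (adj : ∀ u v → Adj σ u v ⇔ Adj π (f u) (f v)) where
  opposite : ∀ {u v} → Adj σ u v → isLeft (f u) ≡ not (isLeft (f v))
  opposite {u} {v} a = ¬-not (adjacent-crosses (f u) (f v) (Equivalence.to (adj u v) a))

  left-images : ∀ p → isLeft p ≡ true → isLeft (f p) ≡ isLeft (f (C , fzero))
  left-images p left = trans (opposite (seen-by-d₁ {k} {σ} p left)) (sym (opposite (seen-by-d₁ {k} {σ} (C , fzero) refl)))

  right-images : ∀ q → isLeft q ≡ false → isLeft (f q) ≡ not (isLeft (f (C , fzero)))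
  right-images q right = trans (sym (not-involutive _)) (cong not (sym (opposite (sees-right {k} {σ} q right))))

record SidePreservingEmbedding (m n : ℕ) : Set where
  field
    embed : Vertex m → Vertex n
    injective : Injective _≡_ _≡_ embed
    adjacency : ∀ u v → TAdj m u v ⇔ TAdj n (embed u) (embed v)
    sides : ∀ v → isLeft (embed v) ≡ isLeft v

-- Precomposing with swap if necessary, every induced embedding keeps the sides.
side-preserving : ∀ t u → InducedSubgraphOf (TAdj (size t)) (TAdj (size u)) → SidePreservingEmbedding (size t) (size u)
side-preserving t u (f , f-injective , f-adjacency) with isLeft (f (C , fzero)) in c₁-side
... | true = record { embed = f ; injective = f-injective ; adjacency = f-adjacency ; sides = kept }
  where
  open ImageSides f f-adjacency
  kept : ∀ v → isLeft (f v) ≡ isLeft v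
  kept (A , i) = trans (left-images (A , i) refl) c₁-side
  kept (B , i) = trans (right-images (B , i) refl) (cong not c₁-side)
  kept (C , i) = trans (left-images (C , i) refl) c₁-side
  kept (D , i) = trans (right-images (D , i) refl) (cong not c₁-side)
... | false = record { embed = f ∘ swap ; injective = injective ; adjacency = adjacency ; sides = kept }
  where
  open ImageSides f f-adjacency
  injective : Injective _≡_ _≡_ (f ∘ swap)
  injective {v} {w} e = trans (sym (swap-involutive v)) (trans (cong swap (f-injective e)) (swap-involutive w))
  adjacency : ∀ v w → TAdj (size t) v w ⇔ TAdj (size u) (f (swap v)) (f (swap w))
  adjacency v w = ⇔-trans (swap-adjacency (PiStar.π-involutive t) v w) (f-adjacency (swap v) (swap w))
  kept : ∀ v → isLeft (f (swap v)) ≡ isLeft v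
  kept (A , i) = trans (right-images (B , i) refl) (cong not c₁-side)
  kept (B , i) = trans (left-images (A , i) refl) c₁-side
  kept (C , i) = trans (right-images (D , i) refl) (cong not c₁-side)
  kept (D , i) = trans (left-images (C , i) refl) c₁-side

Edge-cong : ∀ π k {x x' y y'} → x ≡ x' → y ≡ y' → Edge π k x y ⇔ Edge π k x' y'
Edge-cong _ _ refl refl = ⇔-refl

record PositionEmbedding (m n : ℕ) : Set where
  field
    α β : ℕ → ℕ
    α-positive : ∀ x → 1 ≤ α x
    α-injective : ∀ {x x'} → Pos (m + m) x → Pos (m + m) x' → α x ≡ α x' → x ≡ x'
    β-injective : ∀ {y y'} → Pos (m + m) y → Pos (m + m) y' → β y ≡ β y' → y ≡ y'
    edges : ∀ {x y} → Pos (m + m) x → Pos (m + m) y →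
            Edge (piStar m) m x y ⇔ Edge (piStar n) n (α x) (β y)

to-positions : ∀ t u → SidePreservingEmbedding (size t) (size u) → PositionEmbedding (size t) (size u)
to-positions t u g = record
  { α = λ x → pos (embed (leftAt m x))
  ; β = λ y → pos (embed (rightAt m y))
  ; α-positive = λ x → pos-positive (embed (leftAt m x))
  ; α-injective = recover (leftAt m) (pos-leftAt m) (leftAt-left m)
  ; β-injective = recover (rightAt m) (pos-rightAt m) (rightAt-right m)
  ; edges = edges
  }
  where
  open SidePreservingEmbedding g
  m n : ℕ
  m = size t
  n = size u
  recover : (V : ℕ → Vertex m) {s : Bool} → (∀ {x} → Pos (m + m) x → pos (V x) ≡ x) → (∀ x → isLeft (V x) ≡ s) →
            ∀ {x x'} → Pos (m + m) x → Pos (m + m) x' → pos (embed (V x)) ≡ pos (embed (V x')) → x ≡ x'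
  recover V pos-V side-V {x} {x'} px px' e = begin
    x              ≡⟨ pos-V px ⟨
    pos (V x)      ≡⟨ cong pos (injective (pos-injective _ _ same-side e)) ⟩
    pos (V x')     ≡⟨ pos-V px' ⟩
    x'             ∎
    where
    open ≡-Reasoning
    same-side : isLeft (embed (V x)) ≡ isLeft (embed (V x'))
    same-side = trans (sides (V x)) (trans (side-V x) (sym (trans (sides (V x')) (side-V x'))))
  edges : ∀ {x y} → Pos (m + m) x → Pos (m + m) y →
          Edge (piStar m) m x y ⇔ Edge (piStar n) n (pos (embed (leftAt m x))) (pos (embed (rightAt m y)))
  edges {x} {y} px py = ⇔-trans before (⇔-trans (adjacency p q) after)
    where
    p : Vertex m
    p = leftAt m x
    q : Vertex m
    q = rightAt m y
    before : Edge (piStar m) m x y ⇔ TAdj m p q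
    before = ⇔-trans (Edge-cong (piStar m) m (sym (pos-leftAt m px)) (sym (pos-rightAt m py)))
                     (⇔-sym (adjacency-by-position (proj₂ ∘ PiStar.π-range t) p q (leftAt-left m x) (rightAt-right m y)))
    after : TAdj n (embed p) (embed q) ⇔ Edge (piStar n) n (pos (embed p)) (pos (embed q))
    after = adjacency-by-position (proj₂ ∘ PiStar.π-range u) (embed p) (embed q)
              (trans (sides p) (leftAt-left m x)) (trans (sides q) (rightAt-right m y))

strict-growth : (f : ℕ → ℕ) {a b : ℕ} → (∀ x → a ≤ x → x < b → f x < f (suc x)) →
                ∀ x k → a ≤ x → x + k ≤ b → f x + k ≤ f (x + k)
strict-growth f step x zero a≤x _ = ≤-reflexive (trans (+-identityʳ (f x)) (cong f (sym (+-identityʳ x))))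
strict-growth f {a} {b} step x (suc k) a≤x x+k<b = begin
  f x + suc k        ≡⟨ +-suc (f x) k ⟩
  suc (f x + k)      ≤⟨ s≤s (strict-growth f step x k a≤x (<⇒≤ x+k<b')) ⟩
  suc (f (x + k))    ≤⟨ step (x + k) (≤-trans a≤x (m≤m+n x k)) x+k<b' ⟩
  f (suc (x + k))    ≡⟨ cong f (+-suc x k) ⟨
  f (x + suc k)      ∎
  where
  open ≤-Reasoning
  x+k<b' : x + k < b
  x+k<b' = subst (_≤ b) (+-suc x k) x+k<b

trade : ∀ {a b p q} → a + p ≡ b + q → a < b → q < p
trade {a} {b} {p} {q} e a<b with q <? p
... | yes q<p = q<p
... | no q≮p = contradiction e (<⇒≢ (+-mono-<-≤ a<b (≮⇒≥ q≮p)))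

last-partner-sum : ∀ t → suc ((6 + (t + t)) + (6 + (t + t))) ≡ ((6 + (t + t)) + 4) + (3 + (t + t))
last-partner-sum = solve-∀

window-end : ∀ h → suc (h + h) + 5 ≡ (2 + (1 + h)) + (2 + (1 + h))
window-end = solve-∀

odd-next : ∀ h → suc (suc h + suc h) ≡ suc (h + h) + 2
odd-next = solve-∀

odd+5 : ∀ h → suc (h + h) + 5 ≡ 6 + (h + h)
odd+5 = solve-∀

+3+3 : ∀ a → a + 3 + 3 ≡ suc (a + 5)
+3+3 = solve-∀

module Rigidity (t u : ℕ) (F : PositionEmbedding (size t) (size u)) where
  open PositionEmbedding F
  module σ* = PiStar t
  module π* = PiStar u

  m n : ℕ
  m = size t
  n = size u

  σ π : ℕ → ℕ
  σ = piStar m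
  π = piStar n

  widen : ∀ {x} → Pos m x → Pos (m + m) x
  widen (1≤x , x≤m) = 1≤x , ≤-trans x≤m (m≤m+n m m)

  edge→ : ∀ {x y} → Pos (m + m) x → Pos (m + m) y → Edge σ m x y → Edge π n (α x) (β y)
  edge→ px py = Equivalence.to (edges px py)

  edge← : ∀ {x y} → Pos (m + m) x → Pos (m + m) y → Edge π n (α x) (β y) → Edge σ m x y
  edge← px py = Equivalence.from (edges px py)

  partner : ℕ → ℕ
  partner x = suc (m + m) ∸ σ x

  σ≤2m+1 : ∀ {x} → Pos m x → σ x ≤ suc (m + m)
  σ≤2m+1 px = ≤-trans (proj₂ (σ*.π-range px)) (≤-trans (m≤m+n m m) (n≤1+n _))

  partner-sum : ∀ {x} → Pos m x → partner x + σ x ≡ suc (m + m)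
  partner-sum px = m∸n+n≡m (σ≤2m+1 px)

  partner-unique : ∀ x {y} → y + σ x ≡ suc (m + m) → y ≡ partner x
  partner-unique x {y} e = trans (sym (m+n∸n≡m y (σ x))) (cong (_∸ σ x) e)

  partner-large : ∀ {x} → Pos m x → m < partner x
  partner-large {x} px =
    subst (_≤ partner x) (m+n∸n≡m (suc m) m) (∸-monoʳ-≤ (suc (m + m)) (proj₂ (σ*.π-range px)))

  partner-pos : ∀ {x} → Pos m x → Pos (m + m) (partner x)
  partner-pos px = ≤-trans (s≤s z≤n) (partner-large px) , ∸-monoʳ-≤ (suc (m + m)) (proj₁ (σ*.π-range px))

  partner-injective : ∀ {x x'} → Pos m x → Pos m x' → partner x ≡ partner x' → x ≡ x'
  partner-injective {x} {x'} px px' e = σ*.π-injective px px' (+-cancelˡ-≡ (partner x) _ _ (begin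
    partner x + σ x     ≡⟨ partner-sum px ⟩
    suc (m + m)         ≡⟨ partner-sum px' ⟨
    partner x' + σ x'   ≡⟨ cong (_+ σ x') e ⟨
    partner x + σ x'    ∎))
    where open ≡-Reasoning

  partner-last : partner m ≡ m + 4
  partner-last = begin
    suc (m + m) ∸ σ m              ≡⟨ cong (suc (m + m) ∸_) σ*.π-last ⟩
    suc (m + m) ∸ (m ∸ 3)          ≡⟨ cong (_∸ (m ∸ 3)) (last-partner-sum t) ⟩
    (m + 4) + (m ∸ 3) ∸ (m ∸ 3)    ≡⟨ m+n∸n≡m (m + 4) (m ∸ 3) ⟩
    m + 4                          ∎
    where open ≡-Reasoning

  matching-edge : ∀ {x} → Pos m x → Edge σ m x (partner x)
  matching-edge px = inj₂ (proj₂ px , partner-sum px)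

  sees-beyond : ∀ {x y} → Pos m x → m < y → Edge σ m x y → y ≡ partner x
  sees-beyond (_ , x≤m) m<y (inj₁ y≤x) = contradiction (≤-trans y≤x x≤m) (<⇒≱ m<y)
  sees-beyond {x} _ _ (inj₂ (_ , e)) = partner-unique x e

  sees-from-beyond : ∀ {x y} → m < x → Edge σ m x y → y ≤ x
  sees-from-beyond _ (inj₁ y≤x) = y≤x
  sees-from-beyond m<x (inj₂ (x≤m , _)) = contradiction x≤m (<⇒≱ m<x)

  -- If x' sees two distinct right positions that x misses, then α x < α x':
  -- otherwise both edges would have to become matching edges at α x'.
  separate-left : ∀ {x x' y₁ y₂} → Pos (m + m) x → Pos (m + m) x' → Pos (m + m) y₁ → Pos (m + m) y₂ →
                  y₁ ≢ y₂ → Edge σ m x' y₁ → ¬ Edge σ m x y₁ → Edge σ m x' y₂ → ¬ Edge σ m x y₂ → α x < α x'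
  separate-left {x} {x'} {y₁} {y₂} px px' py₁ py₂ y₁≢y₂ e₁ ne₁ e₂ ne₂ with α x <? α x'
  ... | yes α<α' = α<α'
  ... | no α≮α' = contradiction (β-injective py₁ py₂ (+-cancelʳ-≡ _ _ _ same-sum)) y₁≢y₂
    where
    matched : ∀ {y} → Pos (m + m) y → Edge σ m x' y → ¬ Edge σ m x y → β y + π (α x') ≡ suc (n + n)
    matched py e ne with edge→ px' py e
    ... | inj₁ βy≤α' = contradiction (edge← px py (inj₁ (≤-trans βy≤α' (≮⇒≥ α≮α')))) ne
    ... | inj₂ (_ , sum) = sum
    same-sum : β y₁ + π (α x') ≡ β y₂ + π (α x')
    same-sum = trans (matched py₁ e₁ ne₁) (sym (matched py₂ e₂ ne₂))

  separate-right : ∀ {y y' x₁ x₂} → Pos (m + m) y → Pos (m + m) y' → Pos (m + m) x₁ → Pos (m + m) x₂ →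
                   x₁ ≢ x₂ → Edge σ m x₁ y → ¬ Edge σ m x₁ y' → Edge σ m x₂ y → ¬ Edge σ m x₂ y' → β y < β y'
  separate-right {y} {y'} {x₁} {x₂} py py' px₁ px₂ x₁≢x₂ e₁ ne₁ e₂ ne₂ with β y <? β y'
  ... | yes β<β' = β<β'
  ... | no β≮β' = contradiction (α-injective px₁ px₂ (π*.π-injective (α-positive _ , proj₁ m₁) (α-positive _ , proj₁ m₂)
                                   (+-cancelˡ-≡ (β y) _ _ (trans (proj₂ m₁) (sym (proj₂ m₂)))))) x₁≢x₂
    where
    matched : ∀ {x} → Pos (m + m) x → Edge σ m x y → ¬ Edge σ m x y' → α x ≤ n × β y + π (α x) ≡ suc (n + n)
    matched px e ne with edge→ px py e
    ... | inj₁ βy≤αx = contradiction (edge← px py' (inj₁ (≤-trans (≮⇒≥ β≮β') βy≤αx))) ne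
    ... | inj₂ r = r
    m₁ : α x₁ ≤ n × β y + π (α x₁) ≡ suc (n + n)
    m₁ = matched px₁ e₁ ne₁
    m₂ : α x₂ ≤ n × β y + π (α x₂) ≡ suc (n + n)
    m₂ = matched px₂ e₂ ne₂

  -- α is strictly increasing on the A-positions 1 … m: x' sees x' and its partner, x sees neither.
  α-increasing : ∀ {x x'} → 1 ≤ x → x < x' → x' ≤ m → α x < α x'
  α-increasing {x} {x'} 1≤x x<x' x'≤m =
    separate-left (widen px) (widen px') (widen px') (partner-pos px') x'≢partner
      (inj₁ ≤-refl) misses-x' (matching-edge px') misses-partner
    where
    px : Pos m x
    px = 1≤x , ≤-trans (<⇒≤ x<x') x'≤m
    px' : Pos m x'
    px' = ≤-trans 1≤x (<⇒≤ x<x') , x'≤m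
    x'≢partner : x' ≢ partner x'
    x'≢partner = <⇒≢ (≤-<-trans x'≤m (partner-large px'))
    misses-x' : ¬ Edge σ m x x'
    misses-x' (inj₁ x'≤x) = <⇒≱ x<x' x'≤x
    misses-x' (inj₂ (_ , e)) = <⇒≱ (partner-large px) (subst (_≤ m) (partner-unique x e) x'≤m)
    misses-partner : ¬ Edge σ m x (partner x')
    misses-partner e = <⇒≢ x<x' (sym (partner-injective px' px (sees-beyond px (partner-large px') e)))

  α-step : ∀ x → 1 ≤ x → x < m → α x < α (suc x)
  α-step x 1≤x x<m = α-increasing 1≤x ≤-refl x<m

  α-growth : ∀ x k → 1 ≤ x → x + k ≤ m → α x + k ≤ α (x + k)
  α-growth = strict-growth α α-step

  -- Past the last A-position: m + 2 sees m + 1 and m + 2, which m misses.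
  α-beyond-last : α m < α (m + 2)
  α-beyond-last = separate-left (widen (s≤s z≤n , ≤-refl)) (beyond 2≤m) (beyond 1≤m) (beyond 2≤m)
    (λ e → 1+n≢n (sym (+-cancelˡ-≡ m 1 2 e)))
    (inj₁ (+-monoʳ-≤ m 1≤2)) (misses {1} ≤-refl λ ()) (inj₁ ≤-refl) (misses {2} 1≤2 λ ())
    where
    1≤2 : 1 ≤ 2
    1≤2 = s≤s z≤n
    1≤m : 1 ≤ m
    1≤m = s≤s z≤n
    2≤m : 2 ≤ m
    2≤m = s≤s (s≤s z≤n)
    beyond : ∀ {k} → k ≤ m → Pos (m + m) (m + k)
    beyond k≤m = s≤s z≤n , +-monoʳ-≤ m k≤m
    misses : ∀ {k} → 1 ≤ k → k ≢ 4 → ¬ Edge σ m m (m + k)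
    misses 1≤k _ (inj₁ m+k≤m) = <⇒≱ (m<m+n m 1≤k) m+k≤m
    misses _ k≢4 (inj₂ (_ , e)) = k≢4 (+-cancelˡ-≡ m _ _ (trans (partner-unique m e) partner-last))

  overtaken : ∀ {x} → Pos m x → ∃[ x⁺ ] Pos (m + m) x⁺ × α x < α x⁺ × ¬ Edge σ m x⁺ (partner x)
  overtaken {x} px@(1≤x , x≤m) with m≤n⇒m<n∨m≡n x≤m
  ... | inj₁ x<m = suc x , widen px⁺ , α-step x 1≤x x<m , misses
    where
    px⁺ : Pos m (suc x)
    px⁺ = s≤s z≤n , x<m
    misses : ¬ Edge σ m (suc x) (partner x)
    misses e = 1+n≢n (sym (partner-injective px px⁺ (sees-beyond px⁺ (partner-large px) e)))
  ... | inj₂ refl = m + 2 , (s≤s z≤n , +-monoʳ-≤ m (s≤s (s≤s z≤n))) , α-beyond-last , misses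
    where
    misses : ¬ Edge σ m (m + 2) (partner m)
    misses e = <⇒≱ (+-monoʳ-< m (s≤s (s≤s (s≤s z≤n))))
                    (subst (_≤ m + 2) partner-last (sees-from-beyond (m<m+n m (s≤s z≤n)) e))

  matching-preserved : ∀ {x} → Pos m x → α x ≤ n × β (partner x) + π (α x) ≡ suc (n + n)
  matching-preserved px with edge→ (widen px) (partner-pos px) (matching-edge px)
  ... | inj₂ matched = matched
  ... | inj₁ β≤α with overtaken px
  ... | x⁺ , px⁺ , α<α⁺ , misses =
    contradiction (edge← px⁺ (partner-pos px) (inj₁ (≤-trans β≤α (<⇒≤ α<α⁺)))) misses

  α-bounded : ∀ {x} → Pos m x → α x ≤ n
  α-bounded px = proj₁ (matching-preserved px)

  -- β is increasing on partners: partner i is seen by itself and by i, both of which miss partner j.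
  β-partner-increasing : ∀ {i j} → Pos m i → Pos m j → partner i < partner j → β (partner i) < β (partner j)
  β-partner-increasing {i} {j} pi pj p<p' =
    separate-right (partner-pos pi) (partner-pos pj) (partner-pos pi) (widen pi) partner≢i
      (inj₁ ≤-refl) (λ e → <⇒≱ p<p' (sees-from-beyond (partner-large pi) e))
      (matching-edge pi) (λ e → <⇒≢ p<p' (sym (sees-beyond pi (partner-large pj) e)))
    where
    partner≢i : partner i ≢ i
    partner≢i e = <⇒≢ (≤-<-trans (proj₂ pi) (partner-large pi)) (sym e)

  order-transfer : ∀ {i j} → Pos m i → Pos m j → σ j < σ i → π (α j) < π (α i)
  order-transfer pi pj σj<σi =
    trade (trans (proj₂ (matching-preserved pi)) (sym (proj₂ (matching-preserved pj))))
          (β-partner-increasing pi pj (∸-monoʳ-< σj<σi (σ≤2m+1 pi)))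

  pos≤6 : ∀ {x} → 1 ≤ x → x ≤ 6 → Pos m x
  pos≤6 1≤x x≤6 = 1≤x , ≤-trans x≤6 (m≤m+n 6 (t + t))

  pos-top : ∀ {k} → k ≤ 5 → Pos m (m ∸ k)
  pos-top {k} k≤5 = ≤-trans (s≤s z≤n) (∸-monoʳ-≤ m k≤5) , m∸n≤m m k

  -- The fixed points 2 and m - 1 of σ are carried to fixed points of π, because
  -- σ 4 < σ 2 < σ 1 and σ m < σ (m - 1) < σ (m - 3) squeeze their images.
  α-2-fixed : π (α 2) ≡ α 2
  α-2-fixed = π*.π-squeeze (<⇒≤ (α-step 1 ≤-refl (s≤s (s≤s z≤n))))
    (<⇒≤ (α-increasing (s≤s z≤n) (s≤s (s≤s (s≤s z≤n))) (proj₂ p₄)))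
    (order-transfer p₂ p₄ σ4<σ2) (order-transfer p₁ p₂ (s≤s (s≤s (s≤s z≤n))))
    where
    p₁ : Pos m 1
    p₁ = pos≤6 (s≤s z≤n) (s≤s z≤n)
    p₂ : Pos m 2
    p₂ = pos≤6 (s≤s z≤n) (s≤s (s≤s z≤n))
    p₄ : Pos m 4
    p₄ = pos≤6 (s≤s z≤n) (s≤s (s≤s (s≤s (s≤s z≤n))))
    σ4<σ2 : σ 4 < σ 2
    σ4<σ2 = subst (_< 2) (sym (σ*.π-even-odd 0 (proj₂ p₄))) ≤-refl

  α-penult-fixed : π (α (m ∸ 1)) ≡ α (m ∸ 1)
  α-penult-fixed = π*.π-squeeze
    (<⇒≤ (α-increasing (s≤s z≤n) m-3<m-1 (m∸n≤m m 1))) (<⇒≤ (α-step (m ∸ 1) (s≤s z≤n) ≤-refl))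
    (order-transfer (pos-top (s≤s z≤n)) (pos-top z≤n) (subst₂ _<_ (sym σ*.π-last) (sym σ*.π-penult) m-3<m-1))
    (order-transfer (pos-top (s≤s (s≤s (s≤s z≤n)))) (pos-top (s≤s z≤n))
      (subst₂ _<_ (sym σ*.π-penult) (sym σ*.π-third-last) ≤-refl))
    where
    m-3<m-1 : m ∸ 3 < m ∸ 1
    m-3<m-1 = s≤s (s≤s (s≤s (s≤s (n≤1+n (t + t)))))

  -- The only fixed points of π are 2 and n - 1; monotonicity decides which is which.
  α-2-not-penult : α 2 ≢ n ∸ 1
  α-2-not-penult α2≡n-1 = <-irrefl refl (<-≤-trans (≤-<-trans n≤α3 α3<α4) (α-bounded p₄))
    where
    p₄ : Pos m 4
    p₄ = pos≤6 (s≤s z≤n) (s≤s (s≤s (s≤s (s≤s z≤n))))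
    n≤α3 : n ≤ α 3
    n≤α3 = subst (_< α 3) α2≡n-1 (α-step 2 (s≤s z≤n) (s≤s (s≤s (s≤s z≤n))))
    α3<α4 : α 3 < α 4
    α3<α4 = α-step 3 (s≤s z≤n) (s≤s (s≤s (s≤s (s≤s z≤n))))

  α-2 : α 2 ≡ 2
  α-2 = fromInj₁ (λ α2≡n-1 → contradiction α2≡n-1 α-2-not-penult) (π*.π-fixed (α-positive 2) α-2-fixed)

  α-1 : α 1 ≡ 1
  α-1 = ≤-antisym (s≤s⁻¹ (subst (α 1 <_) α-2 (α-step 1 ≤-refl (s≤s (s≤s z≤n))))) (α-positive 1)

  α-penult : α (m ∸ 1) ≡ n ∸ 1
  α-penult = fromInj₂ (λ α≡2 → contradiction (trans α-2 (sym α≡2)) α-2≢α-penult)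
                      (π*.π-fixed (α-positive (m ∸ 1)) α-penult-fixed)
    where
    α-2≢α-penult : α 2 ≢ α (m ∸ 1)
    α-2≢α-penult = <⇒≢ (α-increasing (s≤s z≤n) (s≤s (s≤s (s≤s z≤n))) (m∸n≤m m 1))

  window-room : ∀ {h} → h ≤ t → suc (h + h) + 5 ≤ m
  window-room {h} h≤t = subst (_≤ m) (sym (odd+5 h)) (+-monoʳ-≤ 6 (+-mono-≤ h≤t h≤t))

  -- Upper bound.  σ reverses the ends of every window [i, i + 5] with i odd,
  -- so α cannot stretch such a window: α (i + 5) ≤ α i + 5.
  window : ∀ h → suc (h + h) + 5 ≤ m → α (suc (h + h) + 5) ≤ α (suc (h + h)) + 5
  window h room = s≤s⁻¹ (begin-strict
    α (i + 5)              ≤⟨ π*.π-lower (α (i + 5)) ⟩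
    π (α (i + 5)) + 3      <⟨ +-monoˡ-< 3 (order-transfer pᵢ (s≤s z≤n , room) reversed) ⟩
    π (α i) + 3            ≤⟨ +-monoˡ-≤ 3 (π*.π-upper (α i)) ⟩
    α i + 3 + 3            ≡⟨ +3+3 (α i) ⟩
    suc (α i + 5)          ∎)
    where
    open ≤-Reasoning
    i : ℕ
    i = suc (h + h)
    pᵢ : Pos m i
    pᵢ = s≤s z≤n , ≤-trans (m≤m+n i 5) room
    reversed : σ (i + 5) < σ i
    reversed = begin-strict
      σ (i + 5)                         ≡⟨ cong σ (window-end h) ⟩
      σ ((2 + (1 + h)) + (2 + (1 + h))) ≡⟨ σ*.π-even-odd (1 + h) (subst (_≤ m) (trans (window-end h) (sym (odd-shift (1 + h)))) room) ⟩
      suc ((1 + h) + (1 + h))           ≡⟨ odd-next h ⟩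
      i + 2                             <⟨ +-monoʳ-< i ≤-refl ⟩
      i + 3                             ≡⟨ σ*.π-odd h (≤-trans (+-monoʳ-≤ i (s≤s (s≤s (s≤s z≤n)))) room) ⟨
      σ i                               ∎

  odd-advance : ∀ h → suc (h + h) + 5 ≤ m → α (suc (h + h) + 2) ≤ α (suc (h + h)) + 2
  odd-advance h room = +-cancelʳ-≤ 3 _ _ (begin
    α (i + 2) + 3    ≤⟨ α-growth (i + 2) 3 (s≤s z≤n) (subst (_≤ m) (sym (+-assoc i 2 3)) room) ⟩
    α (i + 2 + 3)    ≡⟨ cong α (+-assoc i 2 3) ⟩
    α (i + 5)        ≤⟨ window h room ⟩
    α i + 5          ≡⟨ +-assoc (α i) 2 3 ⟨
    α i + 2 + 3      ∎)
    where
    open ≤-Reasoning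
    i : ℕ
    i = suc (h + h)

  α-odd-bound : ∀ h → h ≤ t → α (suc (h + h)) ≤ suc (h + h)
  α-odd-bound zero _ = ≤-reflexive α-1
  α-odd-bound (suc h) h<t = begin
    α (suc (suc h + suc h))   ≡⟨ cong α (odd-next h) ⟩
    α (suc (h + h) + 2)       ≤⟨ odd-advance h (window-room (<⇒≤ h<t)) ⟩
    α (suc (h + h)) + 2       ≤⟨ +-monoˡ-≤ 2 (α-odd-bound h (<⇒≤ h<t)) ⟩
    suc (h + h) + 2           ≡⟨ odd-next h ⟨
    suc (suc h + suc h)       ∎
    where open ≤-Reasoning

  α-penult-upper : α (m ∸ 1) ≤ m ∸ 1
  α-penult-upper = s≤s⁻¹ (begin-strict
    α (m ∸ 1)             <⟨ α-step (m ∸ 1) (s≤s z≤n) ≤-refl ⟩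
    α m                   ≡⟨ cong α (odd+5 t) ⟨
    α (suc (t + t) + 5)   ≤⟨ window t (window-room ≤-refl) ⟩
    α (suc (t + t)) + 5   ≤⟨ +-monoˡ-≤ 5 (α-odd-bound t ≤-refl) ⟩
    suc (t + t) + 5       ≡⟨ odd+5 t ⟩
    m                     ∎)
    where open ≤-Reasoning

  -- Lower bound: strict monotonicity from α 1 = 1.
  α-penult-lower : m ∸ 1 ≤ α (m ∸ 1)
  α-penult-lower = subst (λ a → a + (4 + (t + t)) ≤ α (m ∸ 1)) α-1 (α-growth 1 (4 + (t + t)) ≤-refl (n≤1+n (m ∸ 1)))

  rigidity : m ≡ n
  rigidity = cong suc (≤-antisym (subst (m ∸ 1 ≤_) α-penult α-penult-lower) (subst (_≤ m ∸ 1) α-penult α-penult-upper))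

*2≡double : ∀ q → q * 2 ≡ q + q
*2≡double = solve-∀

even-size : ∀ m → 6 ≤ m → 2 ∣ m → ∃[ t ] m ≡ size t
even-size m 6≤m (divides q refl) = q ∸ 3 , (begin
  q * 2                        ≡⟨ *2≡double q ⟩
  q + q                        ≡⟨ cong (λ r → r + r) (m+[n∸m]≡n 3≤q) ⟨
  (3 + (q ∸ 3)) + (3 + (q ∸ 3)) ≡⟨ size-double (q ∸ 3) ⟨
  size (q ∸ 3)                 ∎)
  where
  open ≡-Reasoning
  3≤q : 3 ≤ q
  3≤q = half-< (≤-trans (s≤s (s≤s (s≤s (s≤s (s≤s z≤n))))) (subst (6 ≤_) (*2≡double q) 6≤m))

mainTheorem8 : (m n : ℕ) → 6 ≤ m → 6 ≤ n → 2 ∣ m → 2 ∣ n → m ≢ n →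
    ¬ InducedSubgraphOf (TAdj m) (TAdj n)
mainTheorem8 m n 6≤m 6≤n 2∣m 2∣n m≢n embedding with even-size m 6≤m 2∣m | even-size n 6≤n 2∣n
... | t , refl | u , refl = m≢n (Rigidity.rigidity t u (to-positions t u (side-preserving t u embedding)))
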